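{- Let $P = (B; s, t; \alpha, \beta)$ be a subsequence with $\rho P = P$, and suppose $P$ has odd length. Then $P$ is trivial, i.e. its first and last letters are equal.
   Context: For $\epsilon \in \{0,1\}$, $W_\epsilon^\ell$ is the alternating word of length $\ell$ starting with $\epsilon$. A block decomposition $B = (\epsilon_1; \ell_1, \ldots, \ell_n)$ has word $W_{\epsilon_1}^{\ell_1}\cdots W_{\epsilon_n}^{\ell_n}$, $\epsilon_{i+1} \equiv \epsilon_i + \ell_i - 1 \pmod 2$; write $B^{\mathrm{len}}_i = \ell_i$. A subsequence of the word $\mathrm{word}(B)$ is a contiguous substring of length at least $2$; it is encoded as $P = (B; s, t; \alpha, \beta)$ where $s \le t$ are the blocks in which $P$ starts and ends, $\alpha$ ($0 \le \alpha < B^{\mathrm{len}}_s$) is the number of letters of block $s$ before $P$ and $\beta$ ($0 \le \beta < B^{\mathrm{len}}_t$) the number of letters of block $t$ after $P$ (if $s=t$, $\alpha+\beta+2 \le B^{\mathrm{len}}_s$). Its length is $\sum_{i=s}^t B^{\mathrm{len}}_i - \alpha - \beta$. The reflection $\rho_{s,t}$ reverses the lengths $\ell_s, \ldots, \ell_t$ keeping $\epsilon_1$ and the other lengths, and $\rho P := (\rho_{s,t}B; s, t; \beta, \alpha)$. $P$ is trivial if its first and last letters coincide. -}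

module Defs where

open import Data.Bool using (Bool; true; false; not)
open import Data.Nat using (ℕ; zero; suc; _+_; _∸_; _≤_; _<_)
open import Data.Fin using (Fin; toℕ)
open import Data.List using (List; []; _∷_; _++_; length; drop; take; reverse; lookup)
open import Data.Nat.ListAction using (sum)
open import Data.Product using (_×_; _,_)
open import Data.Maybe using (Maybe; just; nothing)
open import Relation.Binary.PropositionalEquality using (_≡_; _≢_)

-- Letters are Bools: false = 0, true = 1.

alt : Bool → ℕ → List Bool
alt e zero    = []
alt e (suc l) = e ∷ alt (not e) l

-- ε_{i+1} ≡ ε_i + ℓ_i - 1 (mod 2): the next block starts with the last letter
-- of the current block.  For ℓ ≥ 1, ε + ℓ - 1 mod 2 is ε flipped (ℓ-1) times.
flipN : ℕ → Bool → Bool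
flipN zero    e = e
flipN (suc n) e = not (flipN n e)

nextStart : Bool → ℕ → Bool
nextStart e l = flipN (l ∸ 1) e

wordFrom : Bool → List ℕ → List Bool
wordFrom e []       = []
wordFrom e (l ∷ ls) = alt e l ++ wordFrom (nextStart e l) ls

record BlockDecomp : Set where
  constructor blocks
  field
    ε₁   : Bool
    lens : List ℕ

open BlockDecomp public

word : BlockDecomp → List Bool
word B = wordFrom (ε₁ B) (lens B)

data AllPos : List ℕ → Set where
  []  : AllPos []
  _∷_ : ∀ {l ls} → 1 ≤ l → AllPos ls → AllPos (l ∷ ls)

ValidBlocks : BlockDecomp → Set
ValidBlocks B = AllPos (lens B)

-- B^len_i with blocks indexed from 0 (block i of the paper is index i-1);
-- default 0 outside the range (never used there under the hypotheses).
len : BlockDecomp → ℕ → ℕ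
len B i with Data.List.head (drop i (lens B))
... | just l  = l
... | nothing = 0

before : BlockDecomp → ℕ → ℕ
before B k = sum (take k (lens B))

record Subseq : Set where
  constructor subseq
  field
    blk : BlockDecomp
    s t α β : ℕ

open Subseq public

ValidSubseq : Subseq → Set
ValidSubseq P =
  ValidBlocks (blk P) ×
  (s P ≤ t P) × (t P < length (lens (blk P))) ×
  (α P < len (blk P) (s P)) × (β P < len (blk P) (t P)) ×
  (s P ≡ t P → α P + β P + 2 ≤ len (blk P) (s P))

subseqLength : Subseq → ℕ
subseqLength P = (before (blk P) (suc (t P)) ∸ before (blk P) (s P)) ∸ α P ∸ β P

firstPos : Subseq → ℕ
firstPos P = before (blk P) (s P) + α P

lastPos : Subseq → ℕ
lastPos P = before (blk P) (suc (t P)) ∸ β P ∸ 1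

letterAt : List Bool → ℕ → Maybe Bool
letterAt []       _       = nothing
letterAt (x ∷ xs) zero    = just x
letterAt (x ∷ xs) (suc i) = letterAt xs i

firstLetter lastLetter : Subseq → Maybe Bool
firstLetter P = letterAt (word (blk P)) (firstPos P)
lastLetter  P = letterAt (word (blk P)) (lastPos P)

Trivial : Subseq → Set
Trivial P = firstLetter P ≡ lastLetter P

reflectLens : ℕ → ℕ → List ℕ → List ℕ
reflectLens s t ls = take s ls ++ reverse (take (suc t ∸ s) (drop s ls)) ++ drop (suc t) ls

reflectBlocks : ℕ → ℕ → BlockDecomp → BlockDecomp
reflectBlocks s t B = blocks (ε₁ B) (reflectLens s t (lens B))

reflect : Subseq → Subseq
reflect P = subseq (reflectBlocks (s P) (t P) (blk P)) (s P) (t P) (β P) (α P)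

data Odd : ℕ → Set where
  one  : Odd 1
  2+   : ∀ {n} → Odd n → Odd (suc (suc n))

-- ρP = P forces α = β and makes ℓ_s, …, ℓ_t a palindrome. With an even number of terms
-- its sum, and hence the length Σ ℓ_i − 2α, would be even, so t − s is even. Each block
-- boundary repeats a letter, so the letter at position p of block k is ε₁ flipped p − k
-- times; from the first to the last letter of P, p advances by the length − 1 and k by
-- t − s, both even.
module Submission where

open import Defs
open import Data.Bool using (Bool; not)
open import Data.Bool.Properties using (not-involutive)
open import Data.Nat using (ℕ; zero; suc; _+_; _*_; _∸_; _≤_; _<_; s≤s)
open import Data.Nat.Properties
open import Data.Nat.Tactic.RingSolver using (solve-∀)
open import Data.List using (List; []; _∷_; _++_; length; drop; take; reverse)
open import Data.List.Properties using (++-cancelʳ; ∷-injectiveʳ; length-take; length-drop; take++drop≡id; reverse-++; length-reverse)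
open import Data.List.Relation.Binary.Permutation.Propositional.Properties using (↭-reverse)
open import Data.Nat.ListAction using (sum)
open import Data.Nat.ListAction.Properties using (sum-++; sum-↭)
open import Data.Maybe using (just)
open import Data.Product using (∃; _,_)
open import Data.Sum using (_⊎_; inj₁; inj₂)
open import Data.Empty using (⊥-elim)
open import Relation.Nullary using (¬_)
open import Relation.Binary.PropositionalEquality
open ≡-Reasoning

flipN-+ : ∀ m n e → flipN (m + n) e ≡ flipN m (flipN n e)
flipN-+ zero    n e = refl
flipN-+ (suc m) n e = cong not (flipN-+ m n e)

flipN-double : ∀ k e → flipN (k + k) e ≡ e
flipN-double zero    e = refl
flipN-double (suc k) e rewrite +-suc k k = trans (not-involutive _) (flipN-double k e)

flipN-not : ∀ n e → flipN n (not e) ≡ not (flipN n e)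
flipN-not zero    e = refl
flipN-not (suc n) e = cong not (flipN-not n e)

even⊎odd : ∀ n → ∃ λ k → n ≡ k + k ⊎ n ≡ suc (k + k)
even⊎odd zero = 0 , inj₁ refl
even⊎odd (suc n) with even⊎odd n
... | k , inj₁ refl = k , inj₂ refl
... | k , inj₂ refl = suc k , inj₁ (cong suc (sym (+-suc k k)))

Odd⇒≡suc-double : ∀ {n} → Odd n → ∃ λ j → n ≡ suc (j + j)
Odd⇒≡suc-double one = 0 , refl
Odd⇒≡suc-double (2+ o) with Odd⇒≡suc-double o
... | j , refl = suc j , cong (λ m → suc (suc m)) (sym (+-suc j j))

¬Odd-double : ∀ k → ¬ Odd (k + k)
¬Odd-double zero ()
¬Odd-double (suc k) o rewrite +-suc k k with o
... | 2+ o′ = ¬Odd-double k o′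

double-∸-double : ∀ h a → (h + h) ∸ a ∸ a ≡ (h ∸ a) + (h ∸ a)
double-∸-double h a = begin
  (h + h) ∸ a ∸ a   ≡⟨ ∸-+-assoc (h + h) a a ⟩
  (h + h) ∸ (a + a) ≡⟨ cong₂ _∸_ (sym (two* h)) (sym (two* a)) ⟩
  2 * h ∸ 2 * a     ≡⟨ sym (*-distribˡ-∸ 2 h a) ⟩
  2 * (h ∸ a)       ≡⟨ two* (h ∸ a) ⟩
  (h ∸ a) + (h ∸ a) ∎
  where
  two* : ∀ m → 2 * m ≡ m + m
  two* m = cong (m +_) (+-identityʳ m)

∸≡suc⇒≡+ : ∀ m n {k} → m ∸ n ≡ suc k → m ≡ suc k + n
∸≡suc⇒≡+ m       zero    eq = trans eq (sym (+-identityʳ _))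
∸≡suc⇒≡+ (suc m) (suc n) eq = trans (cong suc (∸≡suc⇒≡+ m n eq)) (sym (+-suc _ n))

letterAt-++ʳ : ∀ (xs ys : List Bool) p → letterAt (xs ++ ys) (length xs + p) ≡ letterAt ys p
letterAt-++ʳ []       ys p = refl
letterAt-++ʳ (x ∷ xs) ys p = letterAt-++ʳ xs ys p

length-alt : ∀ e l → length (alt e l) ≡ l
length-alt e zero    = refl
length-alt e (suc l) = cong suc (length-alt (not e) l)

letterAt-alt : ∀ e l a ys → a < l → letterAt (alt e l ++ ys) a ≡ just (flipN a e)
letterAt-alt e (suc l) zero    ys _         = refl
letterAt-alt e (suc l) (suc a) ys (s≤s a<l) =
  trans (letterAt-alt (not e) l a ys a<l) (cong just (flipN-not a e))

-- p + k flips stand for the p − k of the proof idea, avoiding truncated subtraction.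
letterAt-wordFrom : ∀ e ls k a → AllPos ls → a < len (blocks e ls) k →
  letterAt (wordFrom e ls) (sum (take k ls) + a) ≡ just (flipN (sum (take k ls) + a + k) e)
letterAt-wordFrom e (l ∷ ls) zero a _ a<l =
  trans (letterAt-alt e l a _ a<l) (cong (λ m → just (flipN m e)) (sym (+-identityʳ a)))
letterAt-wordFrom e (suc l ∷ ls) (suc k) a (_ ∷ pos) a<l = begin
  letterAt (alt e (suc l) ++ rest) (suc l + S + a)
    ≡⟨ cong (letterAt (alt e (suc l) ++ rest)) position ⟩
  letterAt (alt e (suc l) ++ rest) (length (alt e (suc l)) + (S + a))
    ≡⟨ letterAt-++ʳ (alt e (suc l)) rest (S + a) ⟩
  letterAt rest (S + a)
    ≡⟨ letterAt-wordFrom (flipN l e) ls k a pos a<l ⟩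
  just (flipN (S + a + k) (flipN l e))
    ≡⟨ cong just (sym (flipN-+ (S + a + k) l e)) ⟩
  just (flipN (S + a + k + l) e)
    ≡⟨ cong just (sym (not-involutive _)) ⟩
  just (flipN (suc (suc (S + a + k + l))) e)
    ≡⟨ cong (λ m → just (flipN m e)) (flips S a k l) ⟩
  just (flipN (suc l + S + a + suc k) e) ∎
  where
  S = sum (take k ls)
  rest = wordFrom (flipN l e) ls
  position : suc l + S + a ≡ length (alt e (suc l)) + (S + a)
  position = trans (+-assoc (suc l) S a) (cong (_+ (S + a)) (sym (length-alt e (suc l))))
  flips : ∀ S a k l → suc (suc (S + a + k + l)) ≡ suc l + S + a + suc k
  flips = solve-∀

before-suc : ∀ e ls k → before (blocks e ls) (suc k) ≡ before (blocks e ls) k + len (blocks e ls) k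
before-suc e []       zero    = refl
before-suc e []       (suc k) = refl
before-suc e (l ∷ ls) zero    = +-identityʳ l
before-suc e (l ∷ ls) (suc k) = trans (cong (l +_) (before-suc e ls k)) (sym (+-assoc l _ _))

firstLetter-≡ : ∀ {P} → ValidSubseq P → firstLetter P ≡ just (flipN (firstPos P + s P) (ε₁ (blk P)))
firstLetter-≡ {subseq (blocks e ls) s t α β} (pos , _ , _ , α< , _) = letterAt-wordFrom e ls s α pos α<

lastLetter-≡ : ∀ {P} → ValidSubseq P → lastLetter P ≡ just (flipN (lastPos P + t P) (ε₁ (blk P)))
lastLetter-≡ {subseq (blocks e ls) s t α β} (pos , _ , _ , _ , β< , _) = begin
  letterAt (wordFrom e ls) (sum (take (suc t) ls) ∸ β ∸ 1)
    ≡⟨ cong (letterAt (wordFrom e ls)) inLastBlock ⟩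
  letterAt (wordFrom e ls) (sum (take t ls) + a)
    ≡⟨ letterAt-wordFrom e ls t a pos a<ℓ ⟩
  just (flipN (sum (take t ls) + a + t) e)
    ≡⟨ cong (λ p → just (flipN (p + t) e)) (sym inLastBlock) ⟩
  just (flipN (sum (take (suc t) ls) ∸ β ∸ 1 + t) e) ∎
  where
  ℓ = len (blocks e ls) t
  a = ℓ ∸ β ∸ 1
  β+1≤ℓ : β + 1 ≤ ℓ
  β+1≤ℓ = subst (_≤ ℓ) (+-comm 1 β) β<
  a<ℓ : a < ℓ
  a<ℓ = subst (_< ℓ) (sym (∸-+-assoc ℓ β 1)) (∸-monoʳ-< (m≤n+m 1 β) β+1≤ℓ)
  inLastBlock : sum (take (suc t) ls) ∸ β ∸ 1 ≡ sum (take t ls) + a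
  inLastBlock = begin
    sum (take (suc t) ls) ∸ β ∸ 1      ≡⟨ cong (λ x → x ∸ β ∸ 1) (before-suc e ls t) ⟩
    (sum (take t ls) + ℓ) ∸ β ∸ 1      ≡⟨ ∸-+-assoc _ β 1 ⟩
    (sum (take t ls) + ℓ) ∸ (β + 1)    ≡⟨ +-∸-assoc (sum (take t ls)) β+1≤ℓ ⟩
    sum (take t ls) + (ℓ ∸ (β + 1))    ≡⟨ cong (sum (take t ls) +_) (sym (∸-+-assoc ℓ β 1)) ⟩
    sum (take t ls) + a                ∎

-- Truncated subtraction is harmless here: a positive result forces D ≥ S + α + β.
∸∸∸≡suc⇒∸∸1 : ∀ D S α β {m} → D ∸ S ∸ α ∸ β ≡ suc m → D ∸ β ∸ 1 ≡ S + α + m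
∸∸∸≡suc⇒∸∸1 D S α β {m} eq = begin
  D ∸ β ∸ 1                        ≡⟨ cong (λ x → x ∸ β ∸ 1) D≡ ⟩
  suc m + β + α + S ∸ β ∸ 1        ≡⟨ cong (λ x → x ∸ β ∸ 1) (regroup m β α S) ⟩
  suc (S + α + m) + β ∸ β ∸ 1      ≡⟨ cong (_∸ 1) (m+n∸n≡m (suc (S + α + m)) β) ⟩
  S + α + m                        ∎
  where
  D≡ : D ≡ suc m + β + α + S
  D≡ = ∸≡suc⇒≡+ D S (∸≡suc⇒≡+ (D ∸ S) α (∸≡suc⇒≡+ (D ∸ S ∸ α) β eq))
  regroup : ∀ m β α S → suc m + β + α + S ≡ suc (S + α + m) + β
  regroup = solve-∀

lastPos-≡ : ∀ P {m} → subseqLength P ≡ suc m → lastPos P ≡ firstPos P + m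
lastPos-≡ P = ∸∸∸≡suc⇒∸∸1 (before (blk P) (suc (t P))) (before (blk P) (s P)) (α P) (β P)

flipN-double-+ : ∀ d m e → flipN (d + d + m) e ≡ flipN m e
flipN-double-+ d m e = trans (flipN-+ (d + d) m e) (flipN-double d (flipN m e))

odd-span-trivial : ∀ P {j k} → ValidSubseq P → subseqLength P ≡ suc (j + j) →
                   t P ≡ s P + (k + k) → Trivial P
odd-span-trivial P {j} {k} valid length≡ t≡ = begin
  firstLetter P
    ≡⟨ firstLetter-≡ valid ⟩
  just (flipN (F + s P) e)
    ≡⟨ cong just (sym (flipN-double-+ (j + k) (F + s P) e)) ⟩
  just (flipN ((j + k) + (j + k) + (F + s P)) e)
    ≡⟨ cong (λ x → just (flipN x e)) (regroup j k F (s P)) ⟩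
  just (flipN (F + (j + j) + (s P + (k + k))) e)
    ≡⟨ cong₂ (λ p q → just (flipN (p + q) e)) (sym (lastPos-≡ P length≡)) (sym t≡) ⟩
  just (flipN (lastPos P + t P) e)
    ≡⟨ sym (lastLetter-≡ valid) ⟩
  lastLetter P ∎
  where
  F = firstPos P
  e = ε₁ (blk P)
  regroup : ∀ j k F s → (j + k) + (j + k) + (F + s) ≡ F + (j + j) + (s + (k + k))
  regroup = solve-∀

reflectLens-fixed⇒palindrome : ∀ s n (ls : List ℕ) → reflectLens s (s + n) ls ≡ ls →
  reverse (take (suc n) (drop s ls)) ≡ take (suc n) (drop s ls)
reflectLens-fixed⇒palindrome zero    n ls       eq =
  ++-cancelʳ (drop (suc n) ls) _ _ (trans eq (sym (take++drop≡id (suc n) ls)))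
reflectLens-fixed⇒palindrome (suc s) n []       eq = refl
reflectLens-fixed⇒palindrome (suc s) n (l ∷ ls) eq = reflectLens-fixed⇒palindrome s n ls (∷-injectiveʳ eq)

length-take-suc-drop : ∀ {A : Set} s n (xs : List A) → s + n < length xs → length (take (suc n) (drop s xs)) ≡ suc n
length-take-suc-drop zero    n xs       n<len       = trans (length-take (suc n) xs) (m≤n⇒m⊓n≡m n<len)
length-take-suc-drop (suc s) n (x ∷ xs) (s≤s s+n<len) = length-take-suc-drop s n xs s+n<len

sum-take-suc-+ : ∀ s n (xs : List ℕ) →
  sum (take (suc (s + n)) xs) ≡ sum (take s xs) + sum (take (suc n) (drop s xs))
sum-take-suc-+ zero    n xs       = refl
sum-take-suc-+ (suc s) n []       = refl
sum-take-suc-+ (suc s) n (x ∷ xs) = trans (cong (x +_) (sum-take-suc-+ s n xs)) (sym (+-assoc x _ _))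

take-length-++ : ∀ {A : Set} (xs ys : List A) → take (length xs) (xs ++ ys) ≡ xs
take-length-++ []       ys = refl
take-length-++ (x ∷ xs) ys = cong (x ∷_) (take-length-++ xs ys)

-- The second half of an even palindrome is the reversed first half.
palindrome-sum : ∀ (xs : List ℕ) h → reverse xs ≡ xs → length xs ≡ h + h →
                 sum xs ≡ sum (take h xs) + sum (take h xs)
palindrome-sum xs h palindrome length≡ = begin
  sum xs                    ≡⟨ cong sum (sym (take++drop≡id h xs)) ⟩
  sum (front ++ back)       ≡⟨ sum-++ front back ⟩
  sum front + sum back      ≡⟨ cong (sum front +_) (sym (sum-↭ (↭-reverse back))) ⟩
  sum front + sum (reverse back) ≡⟨ cong (λ ys → sum front + sum ys) (sym front≡) ⟩
  sum front + sum front          ∎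
  where
  front = take h xs
  back = drop h xs
  length-reverse-back : length (reverse back) ≡ h
  length-reverse-back = begin
    length (reverse back) ≡⟨ length-reverse back ⟩
    length back           ≡⟨ length-drop h xs ⟩
    length xs ∸ h         ≡⟨ cong (_∸ h) length≡ ⟩
    h + h ∸ h             ≡⟨ m+n∸n≡m h h ⟩
    h                     ∎
  front≡ : front ≡ reverse back
  front≡ = begin
    take h xs                                   ≡⟨ cong (take h) (sym palindrome) ⟩
    take h (reverse xs)                         ≡⟨ cong (λ ys → take h (reverse ys)) (sym (take++drop≡id h xs)) ⟩
    take h (reverse (front ++ back))            ≡⟨ cong (take h) (reverse-++ front back) ⟩
    take h (reverse back ++ reverse front)      ≡⟨ cong (λ n → take n (reverse back ++ reverse front)) (sym length-reverse-back) ⟩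
    take (length (reverse back)) (reverse back ++ reverse front) ≡⟨ take-length-++ (reverse back) (reverse front) ⟩
    reverse back                                ∎

reflect-fixed⇒even-span : ∀ {P} → ValidSubseq P → reflect P ≡ P → Odd (subseqLength P) →
                          ∃ λ k → t P ≡ s P + (k + k)
reflect-fixed⇒even-span {subseq (blocks e ls) s t α β} (_ , s≤t , t<len , _) fixed odd
  with m≤n⇒∃[o]m+o≡n s≤t
... | n , refl with even⊎odd n
... | k , inj₁ n≡ = k , cong (s +_) n≡
... | k , inj₂ n≡ = ⊥-elim (¬Odd-double (h ∸ α) (subst Odd length≡ odd))
  where
  S = sum (take s ls)
  span = take (suc n) (drop s ls)
  h = sum (take (suc k) span)
  span-sum : sum span ≡ h + h
  span-sum = palindrome-sum span (suc k)
    (reflectLens-fixed⇒palindrome s n ls (cong (λ P → lens (blk P)) fixed))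
    (trans (length-take-suc-drop s n ls t<len) (cong suc (trans n≡ (sym (+-suc k k)))))
  length≡ : sum (take (suc (s + n)) ls) ∸ S ∸ α ∸ β ≡ (h ∸ α) + (h ∸ α)
  length≡ = begin
    sum (take (suc (s + n)) ls) ∸ S ∸ α ∸ β ≡⟨ cong (λ x → x ∸ S ∸ α ∸ β) (sum-take-suc-+ s n ls) ⟩
    S + sum span ∸ S ∸ α ∸ β                ≡⟨ cong (λ x → x ∸ α ∸ β) (m+n∸m≡n S (sum span)) ⟩
    sum span ∸ α ∸ β                        ≡⟨ cong₂ (λ x y → x ∸ α ∸ y) span-sum (cong Subseq.α fixed) ⟩
    h + h ∸ α ∸ α                           ≡⟨ double-∸-double h α ⟩
    (h ∸ α) + (h ∸ α)                       ∎

lemma5p2 : (P : Subseq) → ValidSubseq P → reflect P ≡ P →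
           Odd (subseqLength P) → Trivial P
lemma5p2 P valid fixed odd =
  let j , length≡ = Odd⇒≡suc-double odd
      k , t≡      = reflect-fixed⇒even-span valid fixed odd
  in  odd-span-trivial P {j} {k} valid length≡ t≡
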